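{- In the edge-distinguishing game (EDGe) played on the cycle $C_5$ (with $\lambda(C_5)$ colors), Player 1 has a winning strategy.
   Context: $C_n$ is the cycle on $n$ vertices. For a positive integer $k$ let $[k]=\{1,\dots,k\}$. A $k$-coloring $c:V(G)\to[k]$ induces $c'(\{u,v\})=\{c(u),c(v)\}$ (a multiset); $c$ is edge-distinguishing if $c'$ is injective, and $\lambda(G)$ is the least $k$ admitting such a coloring. A partial coloring on $U\subseteq V(G)$ has partial induced edge coloring on $G[U]$. EDGe on $G$: two players, Player 1 first, alternately color an uncolored vertex with a color from $[\lambda(G)]$; a move is legal iff afterwards the partial induced edge coloring of the colored vertices is injective. The player making the last legal move wins. A winning strategy guarantees a win regardless of the opponent's play. -}

module Defs where

open import Data.Nat using (ℕ; suc; _<_; _%_)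
open import Data.Fin using (Fin; toℕ; _≟_)
open import Data.Maybe using (Maybe; just; nothing)
open import Data.Product using (_×_; Σ)
open import Data.Sum using (_⊎_)
open import Relation.Nullary using (¬_; yes; no)
open import Relation.Binary.PropositionalEquality using (_≡_)

record Graph : Set₁ where
  field
    n   : ℕ
    Adj : Fin n → Fin n → Set
open Graph public

-- The cycle C_(suc m) on vertices 0,…,m: i ~ j iff j = i+1 mod (suc m)
-- or i = j+1 mod (suc m).  (For m+1 ≥ 3 this is the usual cycle.)
Cycle : ℕ → Graph
Cycle m = record
  { n   = suc m
  ; Adj = λ i j → (suc (toℕ i) % suc m ≡ toℕ j) ⊎ (suc (toℕ j) % suc m ≡ toℕ i) }

C5 : Graph
C5 = Cycle 4

SamePair : {A : Set} → A → A → A → A → Set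
SamePair a b a' b' = (a ≡ a' × b ≡ b') ⊎ (a ≡ b' × b ≡ a')

EdgeDistinguishing : (G : Graph) (k : ℕ) → (Fin (n G) → Fin k) → Set
EdgeDistinguishing G k c =
  ∀ u v x y → Adj G u v → Adj G x y →
  SamePair (c u) (c v) (c x) (c y) → SamePair u v x y

IsLambda : Graph → ℕ → Set
IsLambda G k =
  Σ (Fin (n G) → Fin k) (EdgeDistinguishing G k) ×
  (∀ j → j < k → ¬ Σ (Fin (n G) → Fin j) (EdgeDistinguishing G j))

-- partial colourings: nothing = uncoloured
PartialColoring : Graph → ℕ → Set
PartialColoring G k = Fin (n G) → Maybe (Fin k)

uncolored : (G : Graph) (k : ℕ) → PartialColoring G k
uncolored G k _ = nothing

PartialInjective : (G : Graph) (k : ℕ) → PartialColoring G k → Set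
PartialInjective G k c =
  ∀ u v x y a b a' b' → Adj G u v → Adj G x y →
  c u ≡ just a → c v ≡ just b → c x ≡ just a' → c y ≡ just b' →
  SamePair a b a' b' → SamePair u v x y

update : (G : Graph) (k : ℕ) → PartialColoring G k → Fin (n G) → Fin k →
         PartialColoring G k
update G k c v col w with w ≟ v
... | yes _ = just col
... | no  _ = c w

Legal : (G : Graph) (k : ℕ) → PartialColoring G k → Fin (n G) → Fin k → Set
Legal G k c v col = (c v ≡ nothing) × PartialInjective G k (update G k c v col)

-- Game positions (normal play: whoever makes the last legal move wins).
-- Win  G k c : the player to move from position c has a winning strategy.
data Win  (G : Graph) (k : ℕ) (c : PartialColoring G k) : Set
data Lose (G : Graph) (k : ℕ) (c : PartialColoring G k) : Set

data Win G k c where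
  move : (v : Fin (n G)) (col : Fin k) → Legal G k c v col →
         Lose G k (update G k c v col) → Win G k c

data Lose G k c where
  allMoves : (∀ v col → Legal G k c v col → Win G k (update G k c v col)) →
             Lose G k c

Player1Wins : (G : Graph) (k : ℕ) → Set
Player1Wins G k = Win G k (uncolored G k)

{-# OPTIONS --safe #-}
-- Two colours give only three colour multisets, fewer than the five edges of C₅, while the
-- colouring 0,0,1,1,2 around the cycle induces the five distinct multisets
-- {0,0},{0,1},{1,1},{1,2},{2,0}; hence λ(C₅) = 3, and as λ is unique the game uses three colours.
-- It then lasts at most five moves, and Player 1's win is found by exhaustive search of the
-- game tree, each step of which is certified by a Win/Lose derivation.
module Submission where

open import Defs
open import Data.Nat using (ℕ; zero; suc; _<_; _%_; s≤s)
open import Data.Nat.Properties using (<-cmp) renaming (_≟_ to _≟ℕ_)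
open import Data.Fin using (Fin; zero; suc; toℕ; _≟_; #_)
open import Data.Fin.Properties using (all?; any?)
open import Data.Vec.Functional using ([]; _∷_)
open import Data.Maybe using (Maybe; just; nothing; _<∣>_; _>>=_; from-just)
import Data.Maybe as Maybe
open import Data.Maybe.Properties using (≡-dec)
open import Data.Product using (_×_; ∃; Σ; _,_)
open import Data.Empty using (⊥-elim)
open import Function using (_∘_)
open import Relation.Binary using (Decidable; DecidableEquality; tri<; tri≈; tri>)
open import Relation.Binary.PropositionalEquality using (_≡_; _≗_; refl; sym; subst)
open import Relation.Nullary using (¬_; Dec; yes; no)
open import Relation.Nullary.Decidable using (_×-dec_; _⊎-dec_; _→-dec_; map′; from-yes; from-no)

∃-fun? : ∀ n {k} {P : (Fin n → Fin k) → Set} →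
         (∀ {f g} → f ≗ g → P f → P g) → (∀ f → Dec (P f)) → Dec (∃ P)
∃-fun? zero resp P? = map′ (λ p → _ , p) (λ (f , p) → resp (λ ()) p) (P? [])
∃-fun? (suc n) {P = P} resp P? = map′ fromHeadTail toHeadTail
  (any? λ x → ∃-fun? n (resp ∘ cons-cong x) (P? ∘ (x ∷_)))
  where
  cons-cong : ∀ x {f g : Fin n → _} → f ≗ g → (x ∷ f) ≗ (x ∷ g)
  cons-cong x f≗g zero    = refl
  cons-cong x f≗g (suc i) = f≗g i
  fromHeadTail : (∃ λ x → ∃ λ f → P (x ∷ f)) → ∃ P
  fromHeadTail (x , f , p) = x ∷ f , p
  toHeadTail : ∃ P → ∃ λ x → ∃ λ f → P (x ∷ f)
  toHeadTail (f , p) = f zero , f ∘ suc , resp (λ { zero → refl ; (suc i) → refl }) p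

anyJust : ∀ {m} {A : Set} → (Fin m → Maybe A) → Maybe A
anyJust {zero}  d = nothing
anyJust {suc m} d = d zero <∣> anyJust (d ∘ suc)

allJust : ∀ {m} {P : Fin m → Set} → ((i : Fin m) → Maybe (P i)) → Maybe (∀ i → P i)
allJust {zero}  d = just λ ()
allJust {suc m} d = d zero >>= λ p → Maybe.map (λ q → λ { zero → p ; (suc i) → q i }) (allJust (d ∘ suc))

samePair? : ∀ {A : Set} → DecidableEquality A → (a b a' b' : A) → Dec (SamePair a b a' b')
samePair? _≟ᴬ_ a b a' b' = ((a ≟ᴬ a') ×-dec (b ≟ᴬ b')) ⊎-dec ((a ≟ᴬ b') ×-dec (b ≟ᴬ a'))

edgeDistinguishing-resp : ∀ G {k} {c c' : Fin (n G) → Fin k} → c ≗ c' →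
                          EdgeDistinguishing G k c → EdgeDistinguishing G k c'
edgeDistinguishing-resp G c≗c' ed u v x y uv xy
  rewrite sym (c≗c' u) | sym (c≗c' v) | sym (c≗c' x) | sym (c≗c' y) = ed u v x y uv xy

isLambda-unique : ∀ {G k k'} → IsLambda G k → IsLambda G k' → k ≡ k'
isLambda-unique {k = k} {k'} (c , min) (c' , min') with <-cmp k k'
... | tri< k<k' _ _ = ⊥-elim (min' k k<k' c)
... | tri≈ _ k≡k' _ = k≡k'
... | tri> _ _ k'<k = ⊥-elim (min k' k'<k c')

module _ (G : Graph) (adj? : Decidable (Adj G)) where

  edgeDistinguishing? : ∀ {k} (c : Fin (n G) → Fin k) → Dec (EdgeDistinguishing G k c)
  edgeDistinguishing? c = all? λ u → all? λ v → all? λ x → all? λ y →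
    adj? u v →-dec adj? x y →-dec samePair? _≟_ (c u) (c v) (c x) (c y) →-dec samePair? _≟_ u v x y

  edgeDistinguishingColouring? : ∀ k → Dec (Σ (Fin (n G) → Fin k) (EdgeDistinguishing G k))
  edgeDistinguishingColouring? k = ∃-fun? (n G) (edgeDistinguishing-resp G) edgeDistinguishing?

  module _ {k : ℕ} where

    -- Quantifying over each colour right after its vertex, rather than over all colours first as
    -- PartialInjective does, lets the search discard uncoloured vertices early.
    partialInjective? : ∀ c → Dec (PartialInjective G k c)
    partialInjective? c = map′
      (λ p u v x y a b a' b' uv xy ca cb ca' cb' → p u v x y uv xy a ca b cb a' ca' b' cb')
      (λ p u v x y uv xy a ca b cb a' ca' b' cb' → p u v x y a b a' b' uv xy ca cb ca' cb')
      (all? λ u → all? λ v → all? λ x → all? λ y → adj? u v →-dec adj? x y →-dec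
        all? λ a → colour? u a →-dec all? λ b → colour? v b →-dec
        all? λ a' → colour? x a' →-dec all? λ b' → colour? y b' →-dec
        samePair? _≟_ a b a' b' →-dec samePair? _≟_ u v x y)
      where
      colour? : ∀ w a → Dec (c w ≡ just a)
      colour? w a = ≡-dec _≟_ (c w) (just a)

    legal? : ∀ c v col → Dec (Legal G k c v col)
    legal? c v col = ≡-dec _≟_ (c v) nothing ×-dec partialInjective? (update G k c v col)

    -- A sound game solver; with too little fuel it answers nothing, meaning "unknown".
    win?  : ℕ → (c : PartialColoring G k) → Maybe (Win G k c)
    lose? : ℕ → (c : PartialColoring G k) → Maybe (Lose G k c)
    win? zero c = nothing
    win? (suc fuel) c = anyJust λ v → anyJust λ col → winningMove v col (legal? c v col)
      where
      winningMove : ∀ v col → Dec (Legal G k c v col) → Maybe (Win G k c)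
      winningMove v col (yes l) = Maybe.map (move v col l) (lose? fuel (update G k c v col))
      winningMove v col (no _)  = nothing
    lose? zero c = nothing
    lose? (suc fuel) c = Maybe.map allMoves (allJust λ v → allJust λ col → reply v col (legal? c v col))
      where
      reply : ∀ v col → Dec (Legal G k c v col) →
              Maybe (Legal G k c v col → Win G k (update G k c v col))
      reply v col (yes _) = Maybe.map (λ w _ → w) (win? fuel (update G k c v col))
      reply v col (no ¬l) = just λ l → ⊥-elim (¬l l)

cycle-adj? : ∀ m → Decidable (Adj (Cycle m))
cycle-adj? m u v = (suc (toℕ u) % suc m ≟ℕ toℕ v) ⊎-dec (suc (toℕ v) % suc m ≟ℕ toℕ u)

C5-adj? : Decidable (Adj C5)
C5-adj? = cycle-adj? 4

C5-colouring : Fin 5 → Fin 3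
C5-colouring = # 0 ∷ # 0 ∷ # 1 ∷ # 1 ∷ # 2 ∷ []

C5-noColouring : ∀ j → j < 3 → ¬ Σ (Fin 5 → Fin j) (EdgeDistinguishing C5 j)
C5-noColouring 0 _ = from-no (edgeDistinguishingColouring? C5 C5-adj? 0)
C5-noColouring 1 _ = from-no (edgeDistinguishingColouring? C5 C5-adj? 1)
C5-noColouring 2 _ = from-no (edgeDistinguishingColouring? C5 C5-adj? 2)
C5-noColouring (suc (suc (suc j))) (s≤s (s≤s (s≤s ())))

isLambda-C5 : IsLambda C5 3
isLambda-C5 = (C5-colouring , from-yes (edgeDistinguishing? C5 C5-adj? C5-colouring)) , C5-noColouring

player1Wins-C5 : Player1Wins C5 3
player1Wins-C5 = from-just (win? C5 C5-adj? 6 (uncolored C5 3))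

theorem3p14 : (∃ λ k → IsLambda C5 k) × (∀ k → IsLambda C5 k → Player1Wins C5 k)
theorem3p14 = (3 , isLambda-C5) , λ k λ-is-k →
  subst (Player1Wins C5) (isLambda-unique isLambda-C5 λ-is-k) player1Wins-C5
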